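{- Let $(W_r)_{r\in\mathbb{Z}}$ be a generalized Tribonacci sequence and $(T_r)_{r\in\mathbb{Z}}$ the Tribonacci sequence. For all integers $r$ and $s$: \[ 4W_{r + s} = 2T_{s - 1} W_{r - 4} + (T_{s + 4} - 7T_s )W_r + 4T_s W_{r + 1}, \] \[ 4W_{r + s} = 2T_{s - 4} W_{r - 1} + (4T_{s + 1} - 7T_s )W_r + T_s W_{r + 4}, \] \[ W_{r + s} = T_{s - 1} W_{r - 1} + (T_{s + 1} - T_s )W_r + T_s W_{r + 1}, \] \[ 4W_{r + s} = T_{s - 4} W_{r - 4} + (T_{s + 4} - 11T_s )W_r + T_s W_{r + 4}, \] \[ W_{r + s} = (T_{s + 1} - 2T_s - T_{s - 2} )W_{r - 1} + (T_{s + 1} - 2T_s )W_r + T_s W_{r + 2}. \]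
   Context: Let $W_0,W_1,W_2$ be arbitrary integers, not all zero. The generalized Tribonacci numbers $(W_r)_{r\in\mathbb{Z}}$ are defined by $W_r=W_{r-1}+W_{r-2}+W_{r-3}$ for $r\ge 3$, and extended to negative indices by $W_{ -r}=W_{ -r+3}-W_{ -r+2}-W_{ -r+1}$ (so the recurrence holds for all $r\in\mathbb{Z}$). The Tribonacci numbers $(T_r)_{r\in\mathbb{Z}}$ are the special case $T_0=0$, $T_1=T_2=1$. -}

module Defs where

open import Data.Nat as ℕ using (ℕ; zero; suc)
open import Data.Integer using (ℤ; +_; -[1+_]; _+_; _-_)

-- Generalized Tribonacci sequence W with initial values W₀ = a, W₁ = b, W₂ = c,
-- W_r = W_{r-1} + W_{r-2} + W_{r-3} for r ≥ 3 and
-- W_{-r} = W_{-r+3} - W_{-r+2} - W_{-r+1} for r ≥ 1.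

forward : ℤ → ℤ → ℤ → ℕ → ℤ
forward a b c zero    = a
forward a b c (suc n) = forward b c (a + b + c) n

backward : ℤ → ℤ → ℤ → ℕ → ℤ
backward a b c zero    = a
backward a b c (suc n) = backward (c - b - a) a b n

W : ℤ → ℤ → ℤ → ℤ → ℤ
W a b c (+ n)      = forward a b c n
W a b c -[1+ n ]   = backward a b c (suc n)

T : ℤ → ℤ
T = W (+ 0) (+ 1) (+ 1)

{-# OPTIONS --safe #-}
-- Functions ℤ → ℤ satisfying the Tribonacci recurrence are closed under sums, differences, scalar
-- multiples and shifts, and such a function is determined by its values at −1, 0, 1. For fixed r,
-- both sides of  f (r + s) = T (s − 1) f (r − 1) + (T (s + 1) − T s) f r + T s f (r + 1)  are such
-- functions of s, and they agree at s = −1, 0, 1. The other four identities follow by expanding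
-- f (r ± 4), f (r + 2), T (s ± 4) and T (s − 2) with this formula, leaving polynomial identities.
module Submission where

open import Defs
open import Data.Integer using (ℤ; +_; -[1+_]; _+_; _-_; _*_; -_) renaming (suc to sucℤ)
open import Data.Integer.Properties
  using (+-comm; +-assoc; +-identityˡ; i≡j⇒i-j≡0; i-j≡0⇒i≡j; +-commutativeSemigroup)
open import Algebra.Properties.CommutativeSemigroup +-commutativeSemigroup using (xy∙z≈xz∙y)
open import Data.Integer.Tactic.RingSolver using (solve-∀)
open import Data.Nat as ℕ using (zero; suc)
open import Data.Product using (_×_; _,_; proj₁)
open import Relation.Binary.PropositionalEquality
  using (_≡_; refl; sym; trans; cong; cong₂; module ≡-Reasoning)
open import Relation.Nullary using (¬_)

open ≡-Reasoning

record IsTribonacci (f : ℤ → ℤ) : Set where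
  field recurrence : ∀ n → f (n + + 3) ≡ f (n + + 2) + f (n + + 1) + f n

open IsTribonacci public

ℤ-induction : ∀ {ℓ} (P : ℤ → Set ℓ) → P (+ 0) →
              (∀ n → P n → P (sucℤ n)) → (∀ n → P (sucℤ n) → P n) → ∀ n → P n
ℤ-induction P p₀ up down (+ zero)       = p₀
ℤ-induction P p₀ up down (+ suc k)      = up (+ k) (ℤ-induction P p₀ up down (+ k))
ℤ-induction P p₀ up down -[1+ zero ]    = down -[1+ 0 ] p₀
ℤ-induction P p₀ up down -[1+ suc k ]   = down -[1+ suc k ] (ℤ-induction P p₀ up down -[1+ k ])

sucℤ-+ : ∀ n k → sucℤ n + + k ≡ n + + suc k
sucℤ-+ n k = trans (cong (_+ + k) (+-comm (+ 1) n)) (+-assoc n (+ 1) (+ k))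

forward-rec : ∀ a b c k →
              forward a b c (k ℕ.+ 3) ≡ forward a b c (k ℕ.+ 2) + forward a b c (k ℕ.+ 1) + forward a b c k
forward-rec a b c zero    = sum-reverse a b c
  where sum-reverse : ∀ a b c → a + b + c ≡ c + b + a
        sum-reverse = solve-∀
forward-rec a b c (suc k) = forward-rec b c (a + b + c) k

backward-rec : ∀ a b c k →
               backward a b c (3 ℕ.+ k) ≡ backward a b c k - backward a b c (1 ℕ.+ k) - backward a b c (2 ℕ.+ k)
backward-rec a b c zero    = refl
backward-rec a b c (suc k) = backward-rec (c - b - a) a b k

W-backward : ∀ a b c k → let w = W a b c; n = -[1+ k ] in
             w n ≡ w (n + + 3) - w (n + + 2) - w (n + + 1)
W-backward a b c 0 = refl
W-backward a b c 1 = refl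
W-backward a b c 2 = refl
W-backward a b c (suc (suc (suc j))) = backward-rec a b c (suc j)

W-isTribonacci : ∀ a b c → IsTribonacci (W a b c)
W-isTribonacci a b c .recurrence (+ k)    = forward-rec a b c k
W-isTribonacci a b c .recurrence -[1+ k ] =
  trans (complete (w (n + + 3)) (w (n + + 2)) (w (n + + 1)))
        (cong (λ x → w (n + + 2) + w (n + + 1) + x) (sym (W-backward a b c k)))
  where
    w = W a b c
    n = -[1+ k ]
    complete : ∀ x y z → x ≡ y + z + (x - y - z)
    complete = solve-∀

module _ {f g : ℤ → ℤ} (f-isT : IsTribonacci f) (g-isT : IsTribonacci g) where

  isTribonacci-+ : IsTribonacci (λ n → f n + g n)
  isTribonacci-+ .recurrence n rewrite f-isT .recurrence n | g-isT .recurrence n =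
    interchange (f (n + + 2)) (f (n + + 1)) (f n) (g (n + + 2)) (g (n + + 1)) (g n)
    where interchange : ∀ a b c x y z → a + b + c + (x + y + z) ≡ a + x + (b + y) + (c + z)
          interchange = solve-∀

  isTribonacci-- : IsTribonacci (λ n → f n - g n)
  isTribonacci-- .recurrence n rewrite f-isT .recurrence n | g-isT .recurrence n =
    interchange (f (n + + 2)) (f (n + + 1)) (f n) (g (n + + 2)) (g (n + + 1)) (g n)
    where interchange : ∀ a b c x y z → a + b + c - (x + y + z) ≡ a - x + (b - y) + (c - z)
          interchange = solve-∀

module _ {f : ℤ → ℤ} (f-isT : IsTribonacci f) where

  isTribonacci-*ʳ : ∀ x → IsTribonacci (λ n → f n * x)
  isTribonacci-*ʳ x .recurrence n rewrite f-isT .recurrence n = distrib (f (n + + 2)) (f (n + + 1)) (f n) x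
    where distrib : ∀ a b c x → (a + b + c) * x ≡ a * x + b * x + c * x
          distrib = solve-∀

  isTribonacci-shift : ∀ k → IsTribonacci (λ n → f (n + k))
  isTribonacci-shift k .recurrence n
    rewrite xy∙z≈xz∙y n (+ 3) k | xy∙z≈xz∙y n (+ 2) k | xy∙z≈xz∙y n (+ 1) k = f-isT .recurrence (n + k)

  private
    Window : ℤ → Set
    Window n = f n ≡ + 0 × f (n + + 1) ≡ + 0 × f (n + + 2) ≡ + 0

    vanishes-at : ∀ {i j} → i ≡ j → f j ≡ + 0 → f i ≡ + 0
    vanishes-at i≡j = trans (cong f i≡j)

    window-up : ∀ n → Window n → Window (sucℤ n)
    window-up n (f₀ , f₁ , f₂) =
      vanishes-at (+-comm (+ 1) n) f₁ ,
      vanishes-at (sucℤ-+ n 1) f₂ ,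
      vanishes-at (sucℤ-+ n 2) (trans (f-isT .recurrence n) (cong₂ _+_ (cong₂ _+_ f₂ f₁) f₀))

    window-down : ∀ n → Window (sucℤ n) → Window n
    window-down n (f₁ , f₂ , f₃) = f₀ , f₁′ , f₂′
      where
        f₁′ : f (n + + 1) ≡ + 0
        f₁′ = vanishes-at (sym (+-comm (+ 1) n)) f₁
        f₂′ : f (n + + 2) ≡ + 0
        f₂′ = vanishes-at (sym (sucℤ-+ n 1)) f₂
        f₀ : f n ≡ + 0
        f₀ = begin
          f n                               ≡⟨ +-identityˡ (f n) ⟨
          + 0 + + 0 + f n                   ≡⟨ cong₂ (λ x y → x + y + f n) f₂′ f₁′ ⟨
          f (n + + 2) + f (n + + 1) + f n   ≡⟨ f-isT .recurrence n ⟨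
          f (n + + 3)                       ≡⟨ vanishes-at (sym (sucℤ-+ n 2)) f₃ ⟩
          + 0                               ∎

  isTribonacci-vanishes : f -[1+ 0 ] ≡ + 0 → f (+ 0) ≡ + 0 → f (+ 1) ≡ + 0 → ∀ n → f n ≡ + 0
  isTribonacci-vanishes f₋₁ f₀ f₁ n =
    proj₁ (ℤ-induction Window (window-up -[1+ 0 ] (f₋₁ , f₀ , f₁)) window-up window-down n)

isTribonacci-unique : ∀ {f g} → IsTribonacci f → IsTribonacci g →
                      f -[1+ 0 ] ≡ g -[1+ 0 ] → f (+ 0) ≡ g (+ 0) → f (+ 1) ≡ g (+ 1) → ∀ n → f n ≡ g n
isTribonacci-unique {f} {g} f-isT g-isT e₋₁ e₀ e₁ n =
  i-j≡0⇒i≡j (f n) (g n)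
    (isTribonacci-vanishes (isTribonacci-- f-isT g-isT) (i≡j⇒i-j≡0 e₋₁) (i≡j⇒i-j≡0 e₀) (i≡j⇒i-j≡0 e₁) n)

T-isTribonacci : IsTribonacci T
T-isTribonacci = W-isTribonacci (+ 0) (+ 1) (+ 1)

module _ {f : ℤ → ℤ} (f-isT : IsTribonacci f) where

  addition-formula : ∀ r s → f (r + s) ≡ T (s - + 1) * f (r - + 1) + (T (s + + 1) - T s) * f r + T s * f (r + + 1)
  addition-formula r s =
    trans (cong f (+-comm r s)) (isTribonacci-unique (isTribonacci-shift f-isT r) combination-isT at-₁ at₀ at₁ s)
    where
      P = f (r - + 1)
      Q = f r
      R = f (r + + 1)

      combination-isT : IsTribonacci (λ n → T (n - + 1) * P + (T (n + + 1) - T n) * Q + T n * R)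
      combination-isT =
        isTribonacci-+
          (isTribonacci-+ (isTribonacci-*ʳ (isTribonacci-shift T-isTribonacci (- + 1)) P)
                          (isTribonacci-*ʳ (isTribonacci-- (isTribonacci-shift T-isTribonacci (+ 1)) T-isTribonacci) Q))
          (isTribonacci-*ʳ T-isTribonacci R)

      coordinate₁ : ∀ P Q R → P ≡ + 1 * P + + 0 * Q + + 0 * R
      coordinate₁ = solve-∀
      coordinate₂ : ∀ P Q R → Q ≡ + 0 * P + + 1 * Q + + 0 * R
      coordinate₂ = solve-∀
      coordinate₃ : ∀ P Q R → R ≡ + 0 * P + + 0 * Q + + 1 * R
      coordinate₃ = solve-∀

      at-₁ : f (-[1+ 0 ] + r) ≡ + 1 * P + + 0 * Q + + 0 * R
      at-₁ = trans (cong f (+-comm -[1+ 0 ] r)) (coordinate₁ P Q R)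
      at₀ : f (+ 0 + r) ≡ + 0 * P + + 1 * Q + + 0 * R
      at₀ = trans (cong f (+-identityˡ r)) (coordinate₂ P Q R)
      at₁ : f (+ 1 + r) ≡ + 0 * P + + 0 * Q + + 1 * R
      at₁ = trans (cong f (+-comm (+ 1) r)) (coordinate₃ P Q R)

  -- The coefficients are T (s − 1), T (s + 1) − T s and T s, evaluated at the given s.
  addition-formula₊₄ : ∀ r → f (r + + 4) ≡ + 2 * f (r - + 1) + + 3 * f r + + 4 * f (r + + 1)
  addition-formula₊₄ r = addition-formula r (+ 4)

  addition-formula₋₄ : ∀ r → f (r - + 4) ≡ + 2 * f (r - + 1) + - + 1 * f r + + 0 * f (r + + 1)
  addition-formula₋₄ r = addition-formula r (- + 4)

  addition-formula₊₂ : ∀ r → f (r + + 2) ≡ + 1 * f (r - + 1) + + 1 * f r + + 1 * f (r + + 1)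
  addition-formula₊₂ r = addition-formula r (+ 2)

  addition-formula₋₂ : ∀ r → f (r - + 2) ≡ - + 1 * f (r - + 1) + - + 1 * f r + + 1 * f (r + + 1)
  addition-formula₋₂ r = addition-formula r (- + 2)

module _ {f : ℤ → ℤ} (f-isT : IsTribonacci f) (r s : ℤ) where

  private
    P = f (r - + 1)
    Q = f r
    R = f (r + + 1)
    p = T (s - + 1)
    q = T s
    u = T (s + + 1)

  addition-formula[-4,0,1] : + 4 * f (r + s) ≡
    + 2 * T (s - + 1) * f (r - + 4) + (T (s + + 4) - + 7 * T s) * f r + + 4 * T s * f (r + + 1)
  addition-formula[-4,0,1]
    rewrite addition-formula f-isT r s | addition-formula₋₄ f-isT r | addition-formula₊₄ T-isTribonacci s
    = identity P Q R p q u
    where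
      identity : ∀ P Q R p q u → + 4 * (p * P + (u - q) * Q + q * R)
                   ≡ + 2 * p * (+ 2 * P + - + 1 * Q + + 0 * R) + ((+ 2 * p + + 3 * q + + 4 * u) - + 7 * q) * Q + + 4 * q * R
      identity = solve-∀

  addition-formula[-1,0,4] : + 4 * f (r + s) ≡
    + 2 * T (s - + 4) * f (r - + 1) + (+ 4 * T (s + + 1) - + 7 * T s) * f r + T s * f (r + + 4)
  addition-formula[-1,0,4]
    rewrite addition-formula f-isT r s | addition-formula₊₄ f-isT r | addition-formula₋₄ T-isTribonacci s
    = identity P Q R p q u
    where
      identity : ∀ P Q R p q u → + 4 * (p * P + (u - q) * Q + q * R)
                   ≡ + 2 * (+ 2 * p + - + 1 * q + + 0 * u) * P + (+ 4 * u - + 7 * q) * Q + q * (+ 2 * P + + 3 * Q + + 4 * R)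
      identity = solve-∀

  addition-formula[-4,0,4] : + 4 * f (r + s) ≡
    T (s - + 4) * f (r - + 4) + (T (s + + 4) - + 11 * T s) * f r + T s * f (r + + 4)
  addition-formula[-4,0,4]
    rewrite addition-formula f-isT r s | addition-formula₊₄ f-isT r | addition-formula₋₄ f-isT r
          | addition-formula₊₄ T-isTribonacci s | addition-formula₋₄ T-isTribonacci s
    = identity P Q R p q u
    where
      identity : ∀ P Q R p q u → + 4 * (p * P + (u - q) * Q + q * R)
                   ≡ (+ 2 * p + - + 1 * q + + 0 * u) * (+ 2 * P + - + 1 * Q + + 0 * R)
                     + ((+ 2 * p + + 3 * q + + 4 * u) - + 11 * q) * Q + q * (+ 2 * P + + 3 * Q + + 4 * R)
      identity = solve-∀

  addition-formula[-1,0,2] : f (r + s) ≡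
    (T (s + + 1) - + 2 * T s - T (s - + 2)) * f (r - + 1) + (T (s + + 1) - + 2 * T s) * f r + T s * f (r + + 2)
  addition-formula[-1,0,2]
    rewrite addition-formula f-isT r s | addition-formula₊₂ f-isT r | addition-formula₋₂ T-isTribonacci s
    = identity P Q R p q u
    where
      identity : ∀ P Q R p q u → p * P + (u - q) * Q + q * R
                   ≡ (u - + 2 * q - (- + 1 * p + - + 1 * q + + 1 * u)) * P + (u - + 2 * q) * Q + q * (+ 1 * P + + 1 * Q + + 1 * R)
      identity = solve-∀

corollary2 : (W₀ W₁ W₂ : ℤ) → ¬ (W₀ ≡ + 0 × W₁ ≡ + 0 × W₂ ≡ + 0) → (r s : ℤ) →
    let w = W W₀ W₁ W₂ in
    (+ 4 * w (r + s) ≡ + 2 * T (s - + 1) * w (r - + 4) + (T (s + + 4) - + 7 * T s) * w r + + 4 * T s * w (r + + 1))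
    × (+ 4 * w (r + s) ≡ + 2 * T (s - + 4) * w (r - + 1) + (+ 4 * T (s + + 1) - + 7 * T s) * w r + T s * w (r + + 4))
    × (w (r + s) ≡ T (s - + 1) * w (r - + 1) + (T (s + + 1) - T s) * w r + T s * w (r + + 1))
    × (+ 4 * w (r + s) ≡ T (s - + 4) * w (r - + 4) + (T (s + + 4) - + 11 * T s) * w r + T s * w (r + + 4))
    × (w (r + s) ≡ (T (s + + 1) - + 2 * T s - T (s - + 2)) * w (r - + 1) + (T (s + + 1) - + 2 * T s) * w r + T s * w (r + + 2))
corollary2 W₀ W₁ W₂ _ r s =
  addition-formula[-4,0,1] w-isT r s ,
  addition-formula[-1,0,4] w-isT r s ,
  addition-formula w-isT r s ,
  addition-formula[-4,0,4] w-isT r s ,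
  addition-formula[-1,0,2] w-isT r s
  where
    w-isT : IsTribonacci (W W₀ W₁ W₂)
    w-isT = W-isTribonacci W₀ W₁ W₂
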